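{- For integers $i\ge0$, $j\ge0$ and real $k$: (a) if $i\ge1$ and $j\ge1$, then $\sum_{r=0}^{j}(-1)^{j-r}b_{i,r,1}=b_{i,j+1,0}$; (b) $\sum_{r=0}^{i-1}(-1)^{i-1-r}b_{i,r,k}=i!+(-1)^{i-1}(k-1)^i$; (c) $\sum_{r=0}^{i}(-1)^{r}b_{i,r,k}=(k-1)^i$; (d) $\sum_{r=0}^{i}(-1)^{i-r}b_{i,r,0}=1$.
   Context: For integers $i\ge0$, $j\ge0$ and real $k$, $b_{i,j,k}=\sum_{r=0}^{j}\binom{j}{r}(-1)^{j-r}(r+k)^i$, with the convention $0^0=1$; empty sums are $0$. -}

module Defs where

open import Algebra.Bundles using (CommutativeRing; Semiring)
open import Data.Nat.Base using (ℕ; zero; suc; _∸_)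
open import Data.Nat.Combinatorics using (_C_)

-- All definitions are made over an arbitrary commutative ring R
-- (the paper's k is real; the identities are polynomial in k with
-- integer coefficients).
module WithRing {c ℓ} (R : CommutativeRing c ℓ) where
  open CommutativeRing R
  open import Algebra.Definitions.RawSemiring (Semiring.rawSemiring semiring) public using (_×_; _^_)

  sumBelow : ℕ → (ℕ → Carrier) → Carrier
  sumBelow zero    f = 0#
  sumBelow (suc n) f = sumBelow n f + f n

  sumTo : ℕ → (ℕ → Carrier) → Carrier
  sumTo j f = sumBelow (suc j) f

  sgn : ℕ → Carrier
  sgn n = (- 1#) ^ n

  nat : ℕ → Carrier
  nat n = n × 1#

  -- b_{i,j,k} = Σ_{r=0}^{j} C(j,r) (-1)^{j-r} (r+k)^i   (with x^0 = 1, so 0^0 = 1)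
  b : ℕ → ℕ → Carrier → Carrier
  b i j k = sumTo j (λ r → nat (j C r) * (sgn (j ∸ r) * ((nat r + k) ^ i)))

-- b i j k is the j-th forward difference of t ↦ tⁱ at k.  Two recurrences govern it:
-- Pascal's rule gives b i (j+1) k = b i j (k+1) − b i j k, and the product rule for
-- t · tⁱ together with (r+1)·C(j+1,r+1) = (j+1)·C(j,r) gives
-- b (i+1) (j+1) k = k · b i (j+1) k + (j+1) · b i j (k+1).
-- The second shows that b i j k vanishes for i < j and equals i! for i = j; the first makes
-- the alternating sums Σ_{r≤j} (−1)^{j−r} b i r (k+1) telescope to b i (j+1) k + (−1)^j kⁱ.
-- All four identities are specialisations of this telescoping sum.
module Submission where

open import Defs
open import Algebra.Bundles using (CommutativeRing)
open import Data.Nat.Base using (ℕ; zero; suc; _∸_; _≥_; _!; _≤_; _<_; s≤s)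
open import Data.Nat.Combinatorics using (_C_; nCk+nC[k+1]≡[n+1]C[k+1]; k>n⇒nCk≡0; nC1≡n)
open import Data.Product using (_×_; _,_)
import Data.Nat.Base as ℕ
import Data.Nat.Properties as ℕ
open import Relation.Binary.PropositionalEquality as ≡ using (_≡_)

[1+k]*[1+n]C[1+k]≡[1+n]*nCk : ∀ n k → suc k ℕ.* (suc n C suc k) ≡ suc n ℕ.* (n C k)
[1+k]*[1+n]C[1+k]≡[1+n]*nCk zero    zero    = ≡.refl
[1+k]*[1+n]C[1+k]≡[1+n]*nCk zero    (suc k) = ℕ.*-zeroʳ (2 ℕ.+ k)
[1+k]*[1+n]C[1+k]≡[1+n]*nCk (suc n) zero    =
  ≡.trans (ℕ.*-identityˡ _) (≡.trans (nC1≡n (2 ℕ.+ n)) (≡.sym (ℕ.*-identityʳ (2 ℕ.+ n))))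
[1+k]*[1+n]C[1+k]≡[1+n]*nCk (suc n) (suc k) = begin
  (2 ℕ.+ k) ℕ.* (suc (suc n) C suc (suc k))                     ≡⟨ ≡.cong ((2 ℕ.+ k) ℕ.*_) (≡.sym (pascal (suc n) (suc k))) ⟩
  (2 ℕ.+ k) ℕ.* (c ℕ.+ d)                               ≡⟨ ℕ.*-distribˡ-+ (2 ℕ.+ k) c d ⟩
  (c ℕ.+ suc k ℕ.* c) ℕ.+ (2 ℕ.+ k) ℕ.* d               ≡⟨ ≡.cong₂ (λ u v → (c ℕ.+ u) ℕ.+ v) (IH n k) (IH n (suc k)) ⟩
  (c ℕ.+ suc n ℕ.* a) ℕ.+ suc n ℕ.* b                   ≡⟨ ℕ.+-assoc c _ _ ⟩
  c ℕ.+ (suc n ℕ.* a ℕ.+ suc n ℕ.* b)                   ≡⟨ ≡.cong (c ℕ.+_) (≡.sym (ℕ.*-distribˡ-+ (suc n) a b)) ⟩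
  c ℕ.+ suc n ℕ.* (a ℕ.+ b)                             ≡⟨ ≡.cong (λ u → c ℕ.+ suc n ℕ.* u) (pascal n k) ⟩
  (2 ℕ.+ n) ℕ.* c                                       ∎
  where
  open ≡.≡-Reasoning
  pascal = nCk+nC[k+1]≡[n+1]C[k+1]
  IH = [1+k]*[1+n]C[1+k]≡[1+n]*nCk
  a = n C k
  b = n C suc k
  c = suc n C suc k
  d = suc n C suc (suc k)

module _ {c ℓ} (R : CommutativeRing c ℓ) where
  open CommutativeRing R
  open WithRing R hiding (_×_)
  open import Algebra.Properties.Semiring.Mult semiring using (×1-homo-*; ×-homo-+)
  open import Algebra.Properties.Semiring.Exp semiring using (^-congˡ)
  open import Algebra.Properties.Ring ring using (-1*x≈-x; -‿distribˡ-*; -‿distribʳ-*; -‿+-comm; -‿involutive; -0#≈0#)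
  open import Algebra.Properties.CommutativeSemigroup +-commutativeSemigroup using () renaming (x∙yz≈y∙xz to x+[y+z]≈y+[x+z])
  open import Algebra.Properties.CommutativeSemigroup *-commutativeSemigroup using () renaming (x∙yz≈y∙xz to x*[y*z]≈y*[x*z])
  open import Relation.Binary.Reasoning.Setoid setoid

  sumBelow-cong : ∀ n {f g : ℕ → Carrier} → (∀ r → r < n → f r ≈ g r) → sumBelow n f ≈ sumBelow n g
  sumBelow-cong zero    f≈g = refl
  sumBelow-cong (suc n) f≈g = +-cong (sumBelow-cong n (λ r r<n → f≈g r (ℕ.m<n⇒m<1+n r<n))) (f≈g n (ℕ.n<1+n n))

  sumBelow-distrib-+ : ∀ n (f g : ℕ → Carrier) → sumBelow n (λ r → f r + g r) ≈ sumBelow n f + sumBelow n g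
  sumBelow-distrib-+ zero    f g = sym (+-identityˡ 0#)
  sumBelow-distrib-+ (suc n) f g = begin
    sumBelow n (λ r → f r + g r) + (f n + g n)   ≈⟨ +-congʳ (sumBelow-distrib-+ n f g) ⟩
    (F + G) + (f n + g n)                        ≈⟨ +-assoc F G _ ⟩
    F + (G + (f n + g n))                        ≈⟨ +-congˡ (x+[y+z]≈y+[x+z] G (f n) (g n)) ⟩
    F + (f n + (G + g n))                        ≈⟨ +-assoc F (f n) _ ⟨
    (F + f n) + (G + g n)                        ∎
    where
    F = sumBelow n f
    G = sumBelow n g

  sumBelow-distribˡ-* : ∀ n a (f : ℕ → Carrier) → sumBelow n (λ r → a * f r) ≈ a * sumBelow n f
  sumBelow-distribˡ-* zero    a f = sym (zeroʳ a)
  sumBelow-distribˡ-* (suc n) a f = trans (+-congʳ (sumBelow-distribˡ-* n a f)) (sym (distribˡ a _ (f n)))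

  sumBelow-neg : ∀ n (f : ℕ → Carrier) → sumBelow n (λ r → - f r) ≈ - sumBelow n f
  sumBelow-neg zero    f = sym -0#≈0#
  sumBelow-neg (suc n) f = trans (+-congʳ (sumBelow-neg n f)) (-‿+-comm (sumBelow n f) (f n))

  sumBelow-sucˡ : ∀ n (f : ℕ → Carrier) → sumBelow (suc n) f ≈ f 0 + sumBelow n (λ r → f (suc r))
  sumBelow-sucˡ zero    f = trans (+-identityˡ (f 0)) (sym (+-identityʳ (f 0)))
  sumBelow-sucˡ (suc n) f = trans (+-congʳ (sumBelow-sucˡ n f)) (+-assoc (f 0) _ _)

  sgn-suc : ∀ n → sgn (suc n) ≈ - sgn n
  sgn-suc n = -1*x≈-x (sgn n)

  sgn-suc-∸ : ∀ {j r} → r ≤ j → sgn (suc j ∸ r) ≈ - sgn (j ∸ r)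
  sgn-suc-∸ {j} {r} r≤j = trans (reflexive (≡.cong sgn (ℕ.+-∸-assoc 1 r≤j))) (sgn-suc (j ∸ r))

  sgn*sgn≈1 : ∀ n → sgn n * sgn n ≈ 1#
  sgn*sgn≈1 zero    = *-identityˡ 1#
  sgn*sgn≈1 (suc n) = begin
    sgn (suc n) * sgn (suc n)   ≈⟨ *-cong (sgn-suc n) (sgn-suc n) ⟩
    - sgn n * - sgn n           ≈⟨ -‿distribˡ-* (sgn n) (- sgn n) ⟨
    - (sgn n * - sgn n)         ≈⟨ -‿cong (*-comm (sgn n) (- sgn n)) ⟩
    - (- sgn n * sgn n)         ≈⟨ -‿cong (-‿distribˡ-* (sgn n) (sgn n)) ⟨
    - - (sgn n * sgn n)         ≈⟨ -‿involutive _ ⟩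
    sgn n * sgn n               ≈⟨ sgn*sgn≈1 n ⟩
    1#                          ∎

  sgn≈sgn*sgn[∸] : ∀ {i r} → r ≤ i → sgn r ≈ sgn i * sgn (i ∸ r)
  sgn≈sgn*sgn[∸] {i} {zero}      _         = sym (sgn*sgn≈1 i)
  sgn≈sgn*sgn[∸] {suc i} {suc r} (s≤s r≤i) = trans (*-congˡ (sgn≈sgn*sgn[∸] r≤i)) (sym (*-assoc _ _ _))

  *-sgn-neg : ∀ {s t} n x → s ≈ - t → n * (s * x) ≈ - (n * (t * x))
  *-sgn-neg {s} {t} n x s≈-t = begin
    n * (s * x)     ≈⟨ *-congˡ (*-congʳ s≈-t) ⟩
    n * (- t * x)   ≈⟨ *-congˡ (-‿distribˡ-* t x) ⟨
    n * - (t * x)   ≈⟨ -‿distribʳ-* n (t * x) ⟨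
    - (n * (t * x)) ∎

  -- The j-th forward difference of h at 0; b i j x unfolds to Δ j (λ r → (nat r + x) ^ i).
  Δ : ℕ → (ℕ → Carrier) → Carrier
  Δ j h = sumTo j (λ r → nat (j C r) * (sgn (j ∸ r) * h r))

  Δ-cong : ∀ j {g h : ℕ → Carrier} → (∀ r → g r ≈ h r) → Δ j g ≈ Δ j h
  Δ-cong j g≈h = sumBelow-cong (suc j) (λ r _ → *-congˡ (*-congˡ (g≈h r)))

  Δ-distrib-+ : ∀ j (g h : ℕ → Carrier) → Δ j (λ r → g r + h r) ≈ Δ j g + Δ j h
  Δ-distrib-+ j g h = trans (sumBelow-cong (suc j) (λ r _ → trans (*-congˡ (distribˡ _ (g r) (h r))) (distribˡ _ _ _)))
                            (sumBelow-distrib-+ (suc j) _ _)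

  Δ-distribˡ-* : ∀ j a (h : ℕ → Carrier) → Δ j (λ r → a * h r) ≈ a * Δ j h
  Δ-distribˡ-* j a h = trans (sumBelow-cong (suc j) (λ r _ → pull r)) (sumBelow-distribˡ-* (suc j) a _)
    where
    pull : ∀ r → nat (j C r) * (sgn (j ∸ r) * (a * h r)) ≈ a * (nat (j C r) * (sgn (j ∸ r) * h r))
    pull r = trans (*-congˡ (x*[y*z]≈y*[x*z] _ a (h r))) (x*[y*z]≈y*[x*z] _ a _)

  Δ-suc : ∀ j (h : ℕ → Carrier) → Δ (suc j) h ≈ Δ j (λ r → h (suc r)) - Δ j h
  Δ-suc j h = begin
    Δ (suc j) h                                           ≈⟨ sumBelow-sucˡ (suc j) term⁺ ⟩
    term⁺ 0 + sumBelow (suc j) (λ r → term⁺ (suc r))      ≈⟨ +-cong (*-sgn-neg _ (h 0) (sgn-suc j)) split-sum ⟩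
    - term 0 + (Δ j (λ r → h (suc r)) + sumBelow (suc j) spill)
                                                          ≈⟨ +-congˡ (+-congˡ spill-sum) ⟩
    - term 0 + (Δ j (λ r → h (suc r)) + - rest)           ≈⟨ x+[y+z]≈y+[x+z] _ _ _ ⟩
    Δ j (λ r → h (suc r)) + (- term 0 + - rest)           ≈⟨ +-congˡ (-‿+-comm (term 0) rest) ⟩
    Δ j (λ r → h (suc r)) - (term 0 + rest)               ≈⟨ +-congˡ (-‿cong (sumBelow-sucˡ j term)) ⟨
    Δ j (λ r → h (suc r)) - Δ j h                         ∎
    where
    term⁺ term spill : ℕ → Carrier
    term⁺ r = nat (suc j C r) * (sgn (suc j ∸ r) * h r)
    term  r = nat (j C r) * (sgn (j ∸ r) * h r)
    spill r = nat (j C suc r) * (sgn (j ∸ r) * h (suc r))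
    rest = sumBelow j (λ r → term (suc r))

    split-sum : sumBelow (suc j) (λ r → term⁺ (suc r)) ≈ Δ j (λ r → h (suc r)) + sumBelow (suc j) spill
    split-sum = trans (sumBelow-cong (suc j) (λ r _ → split r)) (sumBelow-distrib-+ (suc j) _ _)
      where
      split : ∀ r → term⁺ (suc r) ≈ nat (j C r) * (sgn (j ∸ r) * h (suc r)) + spill r
      split r = trans (*-congʳ (trans (reflexive (≡.cong nat (≡.sym (nCk+nC[k+1]≡[n+1]C[k+1] j r))))
                                      (×-homo-+ 1# (j C r) (j C suc r))))
                      (distribʳ _ _ _)

    spill-sum : sumBelow (suc j) spill ≈ - rest
    spill-sum = begin
      sumBelow j spill + spill j                 ≈⟨ +-congˡ (trans (*-congʳ (reflexive (≡.cong nat (k>n⇒nCk≡0 (ℕ.n<1+n j))))) (zeroˡ _)) ⟩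
      sumBelow j spill + 0#                      ≈⟨ +-identityʳ _ ⟩
      sumBelow j spill                           ≈⟨ sumBelow-cong j (λ r r<j → *-sgn-neg _ _ (sgn-suc-∸ r<j)) ⟩
      sumBelow j (λ r → - term (suc r))          ≈⟨ sumBelow-neg j _ ⟩
      - rest                                     ∎

  Δ-*-index : ∀ j (f : ℕ → Carrier) → Δ (suc j) (λ r → nat r * f r) ≈ nat (suc j) * Δ j (λ r → f (suc r))
  Δ-*-index j f = begin
    Δ (suc j) (λ r → nat r * f r)
      ≈⟨ sumBelow-sucˡ (suc j) _ ⟩
    nat 1 * (sgn (suc j) * (0# * f 0)) + sumBelow (suc j) (λ r → nat (suc j C suc r) * (sgn (j ∸ r) * (nat (suc r) * f (suc r))))
      ≈⟨ +-cong (trans (*-congˡ (trans (*-congˡ (zeroˡ (f 0))) (zeroʳ _))) (zeroʳ _)) (sumBelow-cong (suc j) (λ r _ → absorb r)) ⟩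
    0# + sumBelow (suc j) (λ r → nat (suc j) * (nat (j C r) * (sgn (j ∸ r) * f (suc r))))
      ≈⟨ +-identityˡ _ ⟩
    sumBelow (suc j) (λ r → nat (suc j) * (nat (j C r) * (sgn (j ∸ r) * f (suc r))))
      ≈⟨ sumBelow-distribˡ-* (suc j) (nat (suc j)) _ ⟩
    nat (suc j) * Δ j (λ r → f (suc r))
      ∎
    where
    absorb : ∀ r → nat (suc j C suc r) * (sgn (j ∸ r) * (nat (suc r) * f (suc r)))
                   ≈ nat (suc j) * (nat (j C r) * (sgn (j ∸ r) * f (suc r)))
    absorb r = begin
      nat (suc j C suc r) * (sgn (j ∸ r) * (nat (suc r) * f (suc r)))   ≈⟨ *-congˡ (x*[y*z]≈y*[x*z] _ _ _) ⟩
      nat (suc j C suc r) * (nat (suc r) * (sgn (j ∸ r) * f (suc r)))   ≈⟨ *-assoc _ _ _ ⟨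
      (nat (suc j C suc r) * nat (suc r)) * (sgn (j ∸ r) * f (suc r))   ≈⟨ *-congʳ (*-comm _ _) ⟩
      (nat (suc r) * nat (suc j C suc r)) * (sgn (j ∸ r) * f (suc r))   ≈⟨ *-congʳ (×1-homo-* (suc r) (suc j C suc r)) ⟨
      nat (suc r ℕ.* (suc j C suc r)) * (sgn (j ∸ r) * f (suc r))       ≈⟨ *-congʳ (reflexive (≡.cong nat ([1+k]*[1+n]C[1+k]≡[1+n]*nCk j r))) ⟩
      nat (suc j ℕ.* (j C r)) * (sgn (j ∸ r) * f (suc r))               ≈⟨ *-congʳ (×1-homo-* (suc j) (j C r)) ⟩
      (nat (suc j) * nat (j C r)) * (sgn (j ∸ r) * f (suc r))           ≈⟨ *-assoc _ _ _ ⟩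
      nat (suc j) * (nat (j C r) * (sgn (j ∸ r) * f (suc r)))           ∎

  b-zero : ∀ i x → b i 0 x ≈ x ^ i
  b-zero i x = begin
    0# + (1# + 0#) * (1# * (0# + x) ^ i)   ≈⟨ +-identityˡ _ ⟩
    (1# + 0#) * (1# * (0# + x) ^ i)        ≈⟨ *-congʳ (+-identityʳ 1#) ⟩
    1# * (1# * (0# + x) ^ i)               ≈⟨ trans (*-identityˡ _) (*-identityˡ _) ⟩
    (0# + x) ^ i                           ≈⟨ ^-congˡ i (+-identityˡ x) ⟩
    x ^ i                                  ∎

  shift-base : ∀ i r x → (nat (suc r) + x) ^ i ≈ (nat r + (x + 1#)) ^ i
  shift-base i r x = ^-congˡ i (begin
    (1# + nat r) + x   ≈⟨ +-assoc 1# (nat r) x ⟩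
    1# + (nat r + x)   ≈⟨ x+[y+z]≈y+[x+z] 1# (nat r) x ⟩
    nat r + (1# + x)   ≈⟨ +-congˡ (+-comm 1# x) ⟩
    nat r + (x + 1#)   ∎)

  b-suc-index : ∀ i j {x y} → y ≈ x + 1# → b i (suc j) x ≈ b i j y - b i j x
  b-suc-index i j {x} y≈x+1 =
    trans (Δ-suc j _) (+-congʳ (Δ-cong j (λ r → trans (shift-base i r x) (^-congˡ i (+-congˡ (sym y≈x+1))))))

  b-suc-degree : ∀ i j x → b (suc i) (suc j) x ≈ x * b i (suc j) x + nat (suc j) * b i j (x + 1#)
  b-suc-degree i j x = begin
    b (suc i) (suc j) x                                           ≈⟨ Δ-cong (suc j) (λ r → trans (distribʳ _ (nat r) x) (+-comm _ _)) ⟩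
    Δ (suc j) (λ r → x * g r + nat r * g r)                       ≈⟨ Δ-distrib-+ (suc j) _ _ ⟩
    Δ (suc j) (λ r → x * g r) + Δ (suc j) (λ r → nat r * g r)     ≈⟨ +-cong (Δ-distribˡ-* (suc j) x g) (Δ-*-index j g) ⟩
    x * b i (suc j) x + nat (suc j) * Δ j (λ r → g (suc r))       ≈⟨ +-congˡ (*-congˡ (Δ-cong j (λ r → shift-base i r x))) ⟩
    x * b i (suc j) x + nat (suc j) * b i j (x + 1#)              ∎
    where
    g : ℕ → Carrier
    g r = (nat r + x) ^ i

  b-vanishes : ∀ {i j} x → i < j → b i j x ≈ 0#
  -- b 0 j x does not depend on x (the power is 1#), so the two terms of b-suc-index cancel.
  b-vanishes {zero} {suc j} x _ = trans (b-suc-index 0 j {x} refl) (-‿inverseʳ (b 0 j x))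
  b-vanishes {suc i} {suc j} x (s≤s i<j) = begin
    b (suc i) (suc j) x                                  ≈⟨ b-suc-degree i j x ⟩
    x * b i (suc j) x + nat (suc j) * b i j (x + 1#)     ≈⟨ +-cong (*-congˡ (b-vanishes x (ℕ.m<n⇒m<1+n i<j)))
                                                                   (*-congˡ (b-vanishes (x + 1#) i<j)) ⟩
    x * 0# + nat (suc j) * 0#                            ≈⟨ +-cong (zeroʳ x) (zeroʳ _) ⟩
    0# + 0#                                              ≈⟨ +-identityˡ 0# ⟩
    0#                                                   ∎

  b-diagonal : ∀ i x → b i i x ≈ nat (i !)
  b-diagonal zero    x = trans (b-zero 0 x) (sym (+-identityʳ 1#))
  b-diagonal (suc i) x = begin
    b (suc i) (suc i) x                                  ≈⟨ b-suc-degree i i x ⟩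
    x * b i (suc i) x + nat (suc i) * b i i (x + 1#)     ≈⟨ +-cong (*-congˡ (b-vanishes x (ℕ.n<1+n i))) (*-congˡ (b-diagonal i (x + 1#))) ⟩
    x * 0# + nat (suc i) * nat (i !)                     ≈⟨ +-congʳ (zeroʳ x) ⟩
    0# + nat (suc i) * nat (i !)                         ≈⟨ +-identityˡ _ ⟩
    nat (suc i) * nat (i !)                              ≈⟨ ×1-homo-* (suc i) (i !) ⟨
    nat (suc i !)                                        ∎

  alternatingSum : ℕ → (ℕ → Carrier) → Carrier
  alternatingSum j f = sumTo j (λ r → sgn (j ∸ r) * f r)

  alternatingSum-suc : ∀ j (f : ℕ → Carrier) → alternatingSum (suc j) f ≈ f (suc j) - alternatingSum j f
  alternatingSum-suc j f = begin
    sumBelow (suc j) (λ r → sgn (suc j ∸ r) * f r) + sgn (j ∸ j) * f (suc j)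
                                                                         ≈⟨ +-cong earlier last ⟩
    - alternatingSum j f + f (suc j)                                     ≈⟨ +-comm _ _ ⟩
    f (suc j) - alternatingSum j f                                       ∎
    where
    last : sgn (j ∸ j) * f (suc j) ≈ f (suc j)
    last = trans (*-congʳ (reflexive (≡.cong sgn (ℕ.n∸n≡0 j)))) (*-identityˡ _)
    earlier : sumBelow (suc j) (λ r → sgn (suc j ∸ r) * f r) ≈ - alternatingSum j f
    earlier = trans (sumBelow-cong (suc j) (λ r r<1+j → trans (*-congʳ (sgn-suc-∸ (ℕ.≤-pred r<1+j))) (sym (-‿distribˡ-* _ _))))
                    (sumBelow-neg (suc j) _)

  alternatingSum-b : ∀ i j {x y} → y ≈ x + 1# → alternatingSum j (λ r → b i r y) ≈ b i (suc j) x + sgn j * x ^ i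
  alternatingSum-b i zero {x} {y} y≈x+1 = begin
    0# + 1# * b i 0 y                  ≈⟨ trans (+-identityˡ _) (*-identityˡ _) ⟩
    b i 0 y                            ≈⟨ +-identityʳ _ ⟨
    b i 0 y + 0#                       ≈⟨ +-congˡ (-‿inverseˡ (x ^ i)) ⟨
    b i 0 y + (- x ^ i + x ^ i)        ≈⟨ +-assoc _ _ _ ⟨
    (b i 0 y - x ^ i) + x ^ i          ≈⟨ +-cong (+-congˡ (-‿cong (b-zero i x))) (*-identityˡ _) ⟨
    (b i 0 y - b i 0 x) + 1# * x ^ i   ≈⟨ +-congʳ (b-suc-index i 0 y≈x+1) ⟨
    b i 1 x + 1# * x ^ i               ∎
  alternatingSum-b i (suc j) {x} {y} y≈x+1 = begin
    alternatingSum (suc j) (λ r → b i r y)             ≈⟨ alternatingSum-suc j _ ⟩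
    b i (suc j) y - alternatingSum j (λ r → b i r y)   ≈⟨ +-congˡ (-‿cong (alternatingSum-b i j y≈x+1)) ⟩
    b i (suc j) y - (b i (suc j) x + sgn j * x ^ i)    ≈⟨ +-congˡ (-‿+-comm _ _) ⟨
    b i (suc j) y + (- b i (suc j) x + - (sgn j * x ^ i))
                                                       ≈⟨ +-assoc _ _ _ ⟨
    (b i (suc j) y - b i (suc j) x) + - (sgn j * x ^ i)
                                                       ≈⟨ +-cong (b-suc-index i (suc j) y≈x+1)
                                                                 (trans (*-congʳ (sgn-suc j)) (sym (-‿distribˡ-* _ _))) ⟨
    b i (suc (suc j)) x + sgn (suc j) * x ^ i          ∎

  x≈[x-1]+1 : ∀ x → x ≈ (x - 1#) + 1#
  x≈[x-1]+1 x = sym (trans (+-assoc x (- 1#) 1#) (trans (+-congˡ (-‿inverseˡ 1#)) (+-identityʳ x)))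

  alternatingSum-b-at-1 : ∀ {i} j → i ≥ 1 → alternatingSum j (λ r → b i r 1#) ≈ b i (suc j) 0#
  alternatingSum-b-at-1 {suc i} j _ = begin
    alternatingSum j (λ r → b (suc i) r 1#)         ≈⟨ alternatingSum-b (suc i) j (sym (+-identityˡ 1#)) ⟩
    b (suc i) (suc j) 0# + sgn j * (0# * 0# ^ i)    ≈⟨ +-congˡ (trans (*-congˡ (zeroˡ _)) (zeroʳ _)) ⟩
    b (suc i) (suc j) 0# + 0#                       ≈⟨ +-identityʳ _ ⟩
    b (suc i) (suc j) 0#                            ∎

  alternatingSum-b-below-degree : ∀ i k → sumBelow i (λ r → sgn (i ∸ 1 ∸ r) * b i r k) ≈ nat (i !) + (- sgn i) * ((k - 1#) ^ i)
  alternatingSum-b-below-degree zero    k = sym (trans (+-cong (+-identityʳ 1#) (*-identityʳ _)) (-‿inverseʳ 1#))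
  alternatingSum-b-below-degree (suc m) k = begin
    alternatingSum m (λ r → b (suc m) r k)                   ≈⟨ alternatingSum-b (suc m) m (x≈[x-1]+1 k) ⟩
    b (suc m) (suc m) (k - 1#) + sgn m * (k - 1#) ^ suc m    ≈⟨ +-cong (b-diagonal (suc m) (k - 1#)) (*-congʳ sgn≈-sgn-suc) ⟩
    nat (suc m !) + (- sgn (suc m)) * (k - 1#) ^ suc m       ∎
    where
    sgn≈-sgn-suc : sgn m ≈ - sgn (suc m)
    sgn≈-sgn-suc = sym (trans (-‿cong (sgn-suc m)) (-‿involutive _))

  signedSum-b : ∀ i k → sumTo i (λ r → sgn r * b i r k) ≈ (k - 1#) ^ i
  signedSum-b i k = begin
    sumTo i (λ r → sgn r * b i r k)                        ≈⟨ sumBelow-cong (suc i) (λ r r<1+i → trans (*-congʳ (sgn≈sgn*sgn[∸] (ℕ.≤-pred r<1+i))) (*-assoc _ _ _)) ⟩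
    sumTo i (λ r → sgn i * (sgn (i ∸ r) * b i r k))        ≈⟨ sumBelow-distribˡ-* (suc i) (sgn i) _ ⟩
    sgn i * alternatingSum i (λ r → b i r k)               ≈⟨ *-congˡ (alternatingSum-b i i (x≈[x-1]+1 k)) ⟩
    sgn i * (b i (suc i) (k - 1#) + sgn i * K)             ≈⟨ *-congˡ (+-congʳ (b-vanishes (k - 1#) (ℕ.n<1+n i))) ⟩
    sgn i * (0# + sgn i * K)                               ≈⟨ *-congˡ (+-identityˡ _) ⟩
    sgn i * (sgn i * K)                                    ≈⟨ *-assoc _ _ _ ⟨
    (sgn i * sgn i) * K                                    ≈⟨ *-congʳ (sgn*sgn≈1 i) ⟩
    1# * K                                                 ≈⟨ *-identityˡ K ⟩
    K                                                      ∎
    where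
    K = (k - 1#) ^ i

  alternatingSum-b-at-0 : ∀ i → alternatingSum i (λ r → b i r 0#) ≈ 1#
  alternatingSum-b-at-0 i = begin
    alternatingSum i (λ r → b i r 0#)           ≈⟨ alternatingSum-b i i (sym (-‿inverseˡ 1#)) ⟩
    b i (suc i) (- 1#) + sgn i * sgn i          ≈⟨ +-cong (b-vanishes (- 1#) (ℕ.n<1+n i)) (sgn*sgn≈1 i) ⟩
    0# + 1#                                     ≈⟨ +-identityˡ 1# ⟩
    1#                                          ∎

mainTheorem12 : ∀ {c ℓ} (R : CommutativeRing c ℓ) → let open CommutativeRing R in let open WithRing R hiding (_×_) in
    (∀ (i j : ℕ) → i ≥ 1 → j ≥ 1 → sumTo j (λ r → sgn (j ∸ r) * b i r 1#) ≈ b i (suc j) 0#)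
  × (∀ (i : ℕ) (k : Carrier) → sumBelow i (λ r → sgn (i ∸ 1 ∸ r) * b i r k) ≈ nat (i !) + (- sgn i) * ((k - 1#) ^ i))
  × (∀ (i : ℕ) (k : Carrier) → sumTo i (λ r → sgn r * b i r k) ≈ (k - 1#) ^ i)
  × (∀ (i : ℕ) → sumTo i (λ r → sgn (i ∸ r) * b i r 0#) ≈ 1#)
mainTheorem12 R =
    (λ i j i≥1 _ → alternatingSum-b-at-1 R j i≥1)
  , alternatingSum-b-below-degree R
  , signedSum-b R
  , alternatingSum-b-at-0 R
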